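{- Identify the letters by ${\tt a}=1$ and ${\tt b}=-1$. The Thue--Morse word ${\tt w}_{\rm TM}$ is the only word ${\tt w}=\ell_0\ell_1\ell_2\cdots\in\mathcal{W}$ starting with ${\tt a}=1$ such that ${\tt w}=r_{\tt w}(1)r_{\tt w}(2)\cdots r_{\tt w}(n)\cdots$, i.e. such that $\ell_{n-1}=r_{\tt w}(n)$ for all $n\geqslant 1$.
   Context: Words are infinite one-sided words ${\tt w}=\ell_0\ell_1\ell_2\cdots$ over $\Sigma=\{{\tt a},{\tt b}\}$, indexed from position $0$. $\mathcal{W}$ is the set of such words in which both ${\tt a}$ and ${\tt b}$ occur infinitely often. For ${\tt w}\in\mathcal{W}$ and $n\geqslant1$, $p_{\tt a}(n)$ (resp. $p_{\tt b}(n)$) is the position of the $n$-th occurrence of ${\tt a}$ (resp. ${\tt b}$) in ${\tt w}$, and the relative position function is $r_{\tt w}(n)=p_{\tt b}(n)-p_{\tt a}(n)$. The Thue--Morse word ${\tt w}_{\rm TM}=\lim_{n\to\infty}\varrho_{\rm TM}^n({\tt a})$ is the fixed point starting with ${\tt a}$ of the substitution $\varrho_{\rm TM}:{\tt a}\mapsto{\tt a}{\tt b},\ {\tt b}\mapsto{\tt b}{\tt a}$. -}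

module Defs where

open import Data.Nat using (ℕ; zero; suc; _+_; _≤_; _<_)
open import Data.Integer using (ℤ; +_; -[1+_]; _-_)
open import Data.List using (List; []; _∷_; _++_; concatMap; lookup; length)
open import Data.Product using (Σ; ∃; _×_; _,_)
open import Data.Fin using (Fin; fromℕ<)
open import Relation.Binary.PropositionalEquality using (_≡_)
open import Data.Nat.Properties using (≤-refl)

data Letter : Set where
  a b : Letter

Word : Set
Word = ℕ → Letter

InfOften : Word → Letter → Set
InfOften w c = ∀ n → ∃ λ m → n ≤ m × w m ≡ c

In𝒲 : Word → Set
In𝒲 w = InfOften w a × InfOften w b

countBefore : Word → Letter → ℕ → ℕ
countBefore w c zero = zero
countBefore w c (suc p) with w p | c
... | a | a = suc (countBefore w c p)
... | b | b = suc (countBefore w c p)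
... | a | b = countBefore w c p
... | b | a = countBefore w c p

-- p is the position of the n-th occurrence (n ≥ 1) of c in w, i.e. p = p_c(n)
IsNthPos : Word → Letter → ℕ → ℕ → Set
IsNthPos w c n p = w p ≡ c × suc (countBefore w c p) ≡ n

toℤ : Letter → ℤ
toℤ a = + 1
toℤ b = -[1+ 0 ]

-- ℓ_{n-1} = r_w(n) for all n ≥ 1, where r_w(n) = p_b(n) - p_a(n)
-- (positions p_a(n), p_b(n) exist and are unique when w ∈ 𝒲)
SelfRelative : Word → Set
SelfRelative w = ∀ n pa pb → IsNthPos w a (suc n) pa → IsNthPos w b (suc n) pb →
  toℤ (w n) ≡ (+ pb) - (+ pa)

ρTM : Letter → List Letter
ρTM a = a ∷ b ∷ []
ρTM b = b ∷ a ∷ []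

ρTM^ : ℕ → List Letter
ρTM^ zero = a ∷ []
ρTM^ (suc k) = concatMap ρTM (ρTM^ k)

-- |ρ^k(a)| = 2^k > k, and the ρ^k(a) are successive prefixes of w_TM,
-- so the n-th letter of w_TM is the n-th letter of ρ^n(a)
private
  double : (xs : List Letter) → length (concatMap ρTM xs) ≡ length xs + length xs
  double [] = Relation.Binary.PropositionalEquality.refl
  double (a ∷ xs) rewrite double xs = Relation.Binary.PropositionalEquality.cong suc
    (Relation.Binary.PropositionalEquality.sym (Data.Nat.Properties.+-suc _ _))
    where import Data.Nat.Properties
  double (b ∷ xs) rewrite double xs = Relation.Binary.PropositionalEquality.cong suc
    (Relation.Binary.PropositionalEquality.sym (Data.Nat.Properties.+-suc _ _))
    where import Data.Nat.Properties

  lenBound : ∀ n → n < length (ρTM^ n)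
  lenBound zero = Data.Nat.s≤s Data.Nat.z≤n
  lenBound (suc n) rewrite double (ρTM^ n) =
    Data.Nat.Properties.≤-trans (Data.Nat.s≤s (Data.Nat.Properties.m≤n+m (suc n) n))
      (Data.Nat.Properties.+-mono-≤ (lenBound n) (lenBound n))
    where import Data.Nat.Properties

wTM : Word
wTM n = lookup (ρTM^ n) (fromℕ< (lenBound n))

{-# OPTIONS --safe #-}
-- Call a word paired when ℓ(2j+1) ≠ ℓ(2j) for every j. In a paired word
-- every prefix of length 2j holds j letters of each kind, so the (n+1)-th a and the (n+1)-th b
-- occupy the positions 2n and 2n+1, and r(n+1) = ±1 according to ℓ(2n). Hence a word with
-- ℓ(2j) = ℓ(j) and ℓ(2j+1) = flip ℓ(j), which w_TM is by construction, is self-relative.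
-- Conversely, let w be self-relative with a balanced prefix of length 2k, and c = ℓ(2k). Then 2k
-- is the position of the (k+1)-th c, and the (k+1)-th occurrence of flip c is the first one
-- after 2k, say at 2k+1+e. Now ℓ(k) = r(k+1) = ±(1+e) with the sign of c, forcing e = 0 and
-- ℓ(k) = c: the recurrence holds at k and the prefix of length 2k+2 is balanced again. The
-- recurrence together with ℓ(0) = a determines the word.
module Submission where

open import Defs
open import Data.Nat using (ℕ; zero; suc; _+_; _*_; _∸_; _<_; _≤′_; ≤′-refl; ≤′-step; z≤n; s≤s)
open import Data.Nat.Properties
  using (≤-trans; ≤-total; <⇒≤; ≤⇒≤′; m≤m*n; m≤n⇒m≤1+n; m≤n+m; m∸n+n≡m; m+n∸n≡m; +-suc; *-monoˡ-≤;
         suc-injective)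
open import Data.Nat.Induction using (<-rec)
open import Data.Integer using (+_; -[1+_]; _-_; -_)
open import Data.Integer.Properties using ([+m]-[+n]≡m⊖n; ≤-⊖; ⊖-≤)
open import Data.List using (List; []; _∷_; concatMap; lookup; length)
open import Data.List.Relation.Binary.Prefix.Heterogeneous using (Prefix; []; _∷_)
open import Data.List.Relation.Binary.Prefix.Heterogeneous.Properties as Prefix
  using (fromPointwise; ++⁺)
import Data.List.Relation.Binary.Pointwise as Pointwise
open import Data.Fin using (fromℕ<)
open import Data.Product using (_×_; _,_; ∃; proj₁; proj₂)
open import Data.Sum using (_⊎_; inj₁; inj₂)
open import Relation.Nullary using (Dec; yes; no; contradiction)
open import Relation.Binary.PropositionalEquality
  using (_≡_; _≢_; refl; sym; trans; cong; subst)

private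
  variable
    A : Set
    w u v : Word
    c x : Letter
    i j k k′ n p q : ℕ
    xs ys : List A

flip : Letter → Letter
flip a = b
flip b = a

flip-≢ : ∀ x → flip x ≢ x
flip-≢ a ()
flip-≢ b ()

≢⇒flip≡ : x ≢ c → flip x ≡ c
≢⇒flip≡ {a} {a} a≢a = contradiction refl a≢a
≢⇒flip≡ {a} {b} _   = refl
≢⇒flip≡ {b} {a} _   = refl
≢⇒flip≡ {b} {b} b≢b = contradiction refl b≢b

_≟_ : (x y : Letter) → Dec (x ≡ y)
a ≟ a = yes refl
a ≟ b = no λ ()
b ≟ a = no λ ()
b ≟ b = yes refl

toℤ≡+[1+e] : ∀ x e → toℤ x ≡ + suc e → x ≡ a × e ≡ 0
toℤ≡+[1+e] a zero refl = refl , refl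

toℤ≡-[1+e] : ∀ x e → toℤ x ≡ -[1+ e ] → x ≡ b × e ≡ 0
toℤ≡-[1+e] b zero refl = refl , refl

+[m+n]-+n : ∀ m n → + (m + n) - + n ≡ + m
+[m+n]-+n m n = trans ([+m]-[+n]≡m⊖n (m + n) n)
  (trans (≤-⊖ (m≤n+m n m)) (cong +_ (m+n∸n≡m m n)))

+n-+[1+m+n] : ∀ m n → + n - + (suc m + n) ≡ -[1+ m ]
+n-+[1+m+n] m n = trans ([+m]-[+n]≡m⊖n n (suc m + n))
  (trans (⊖-≤ (m≤n+m n (suc m))) (cong (λ d → - + d) (m+n∸n≡m (suc m) n)))

-- Even numbers are written j * 2 rather than 2 * j because suc j * 2 reduces to suc (suc (j * 2)).
data EvenOdd : ℕ → Set where
  even : ∀ j → EvenOdd (j * 2)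
  odd  : ∀ j → EvenOdd (suc (j * 2))

evenOdd : ∀ n → EvenOdd n
evenOdd zero = even zero
evenOdd (suc n) with evenOdd n
... | even j = odd j
... | odd j  = even (suc j)

PairsDiffer : Word → Set
PairsDiffer w = ∀ j → w (suc (j * 2)) ≡ flip (w (j * 2))

ThueMorseRecurrence : Word → Set
ThueMorseRecurrence w = ∀ j → w (j * 2) ≡ w j × w (suc (j * 2)) ≡ flip (w j)

recurrence⇒pairsDiffer : ThueMorseRecurrence w → PairsDiffer w
recurrence⇒pairsDiffer rec j = trans (proj₂ (rec j)) (cong flip (sym (proj₁ (rec j))))

recurrence-unique : ThueMorseRecurrence u → ThueMorseRecurrence v → u 0 ≡ v 0 → ∀ n → u n ≡ v n
recurrence-unique {u} {v} recᵤ recᵥ u₀≡v₀ = <-rec (λ n → u n ≡ v n) agree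
  where
  agree : ∀ n → (∀ {m} → m < n → u m ≡ v m) → u n ≡ v n
  agree n ih with evenOdd n
  ... | even zero    = u₀≡v₀
  ... | even (suc j) = trans (proj₁ (recᵤ (suc j)))
      (trans (ih (s≤s (s≤s (m≤m*n j 2)))) (sym (proj₁ (recᵥ (suc j)))))
  ... | odd j        = trans (proj₂ (recᵤ j))
      (trans (cong flip (ih (s≤s (m≤m*n j 2)))) (sym (proj₂ (recᵥ j))))

pairsDiffer⇒infOften : PairsDiffer w → ∀ c → InfOften w c
pairsDiffer⇒infOften {w} pd c n with w (n * 2) ≟ c
... | yes w[2n]≡c = n * 2 , m≤m*n n 2 , w[2n]≡c
... | no  w[2n]≢c = suc (n * 2) , m≤n⇒m≤1+n (m≤m*n n 2) , trans (pd n) (≢⇒flip≡ w[2n]≢c)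

countBefore-≡ : (w : Word) (p : ℕ) → w p ≡ c → countBefore w c (suc p) ≡ suc (countBefore w c p)
countBefore-≡ {c = a} w p w[p]≡a rewrite w[p]≡a = refl
countBefore-≡ {c = b} w p w[p]≡b rewrite w[p]≡b = refl

countBefore-≢ : (w : Word) (p : ℕ) → w p ≢ c → countBefore w c (suc p) ≡ countBefore w c p
countBefore-≢ {a} w p w[p]≢a with w p
... | a = contradiction refl w[p]≢a
... | b = refl
countBefore-≢ {b} w p w[p]≢b with w p
... | a = refl
... | b = contradiction refl w[p]≢b

pair-≢ : (w : Word) (p : ℕ) → w (suc p) ≡ flip (w p) → w p ≡ c → w (suc p) ≢ c
pair-≢ {c} w p differ w[p]≡c w[p+1]≡c =
  flip-≢ c (trans (sym (trans differ (cong flip w[p]≡c))) w[p+1]≡c)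

countBefore-pair : (w : Word) (p : ℕ) → w (suc p) ≡ flip (w p) →
  countBefore w c (suc (suc p)) ≡ suc (countBefore w c p)
countBefore-pair {c} w p differ with w p ≟ c
... | yes w[p]≡c =
  trans (countBefore-≢ w (suc p) (pair-≢ w p differ w[p]≡c)) (countBefore-≡ w p w[p]≡c)
... | no  w[p]≢c =
  trans (countBefore-≡ w (suc p) (trans differ (≢⇒flip≡ w[p]≢c))) (cong suc (countBefore-≢ w p w[p]≢c))

pairsDiffer⇒countBefore : PairsDiffer w → ∀ c j → countBefore w c (j * 2) ≡ j
pairsDiffer⇒countBefore     pd c zero    = refl
pairsDiffer⇒countBefore {w} pd c (suc j) =
  trans (countBefore-pair w (j * 2) (pd j)) (cong suc (pairsDiffer⇒countBefore pd c j))

pairsDiffer⇒nthPos : PairsDiffer w → IsNthPos w c (suc n) p → p ≡ n * 2 ⊎ p ≡ suc (n * 2)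
pairsDiffer⇒nthPos {w} {c} {n} {p} pd (w[p]≡c , count) with evenOdd p
... | even j = inj₁ (cong (_* 2) (suc-injective (trans (cong suc (sym count[2j]≡j)) count)))
  where
  count[2j]≡j : countBefore w c (j * 2) ≡ j
  count[2j]≡j = pairsDiffer⇒countBefore pd c j
... | odd j  = inj₂ (cong (λ i → suc (i * 2)) (suc-injective (trans (cong suc (sym count[2j+1]≡j)) count)))
  where
  w[2j]≢c : w (j * 2) ≢ c
  w[2j]≢c w[2j]≡c = pair-≢ w (j * 2) (pd j) w[2j]≡c w[p]≡c

  count[2j+1]≡j : countBefore w c (suc (j * 2)) ≡ j
  count[2j+1]≡j = trans (countBefore-≢ w (j * 2) w[2j]≢c) (pairsDiffer⇒countBefore pd c j)

recurrence⇒selfRelative : ThueMorseRecurrence w → SelfRelative w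
recurrence⇒selfRelative {w} rec n pa pb nth-a@(w[pa]≡a , _) nth-b@(w[pb]≡b , _)
  with pairsDiffer⇒nthPos {p = pa} pd nth-a | pairsDiffer⇒nthPos {p = pb} pd nth-b
  where
  pd : PairsDiffer w
  pd = recurrence⇒pairsDiffer rec
... | inj₁ refl | inj₁ refl = contradiction (trans (sym w[pa]≡a) w[pb]≡b) λ ()
... | inj₂ refl | inj₂ refl = contradiction (trans (sym w[pa]≡a) w[pb]≡b) λ ()
... | inj₁ refl | inj₂ refl =
  trans (cong toℤ (trans (sym (proj₁ (rec n))) w[pa]≡a)) (sym (+[m+n]-+n 1 (n * 2)))
... | inj₂ refl | inj₁ refl =
  trans (cong toℤ (trans (sym (proj₁ (rec n))) w[pb]≡b)) (sym (+n-+[1+m+n] 0 (n * 2)))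

infOften : In𝒲 w → ∀ c → InfOften w c
infOften (inf-a , _) a = inf-a
infOften (_ , inf-b) b = inf-b

first-occurrence-within : (w : Word) (d q : ℕ) → w (d + q) ≡ c →
  ∃ λ e → w (e + q) ≡ c × countBefore w c (e + q) ≡ countBefore w c q
first-occurrence-within {c} w d q w[d+q]≡c with w q ≟ c
... | yes w[q]≡c = 0 , w[q]≡c , refl
first-occurrence-within w zero    q w[q]≡c     | no w[q]≢c = contradiction w[q]≡c w[q]≢c
first-occurrence-within {c} w (suc d) q w[1+d+q]≡c | no w[q]≢c
  with e , w[e+1+q]≡c , count ←
         first-occurrence-within w d (suc q) (subst (λ i → w i ≡ c) (sym (+-suc d q)) w[1+d+q]≡c)
  = suc e
  , subst (λ i → w i ≡ c) (+-suc e q) w[e+1+q]≡c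
  , trans (cong (countBefore w c) (sym (+-suc e q))) (trans count (countBefore-≢ w q w[q]≢c))

first-occurrence : InfOften w c → ∀ q →
  ∃ λ e → w (e + q) ≡ c × countBefore w c (e + q) ≡ countBefore w c q
first-occurrence {w} {c} inf q with m , q≤m , w[m]≡c ← inf q
  = first-occurrence-within w (m ∸ q) q (subst (λ i → w i ≡ c) (sym (m∸n+n≡m q≤m)) w[m]≡c)

selfRelative-gap : SelfRelative w → ∀ c k q e →
  IsNthPos w c (suc k) q → IsNthPos w (flip c) (suc k) (suc e + q) → w k ≡ c × e ≡ 0
selfRelative-gap self a k q e nth-a nth-b =
  toℤ≡+[1+e] _ e (trans (self k _ _ nth-a nth-b) (+[m+n]-+n (suc e) q))
selfRelative-gap self b k q e nth-b nth-a =
  toℤ≡-[1+e] _ e (trans (self k _ _ nth-a nth-b) (+n-+[1+m+n] e q))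

selfRelative-recurrence-step : In𝒲 w → SelfRelative w →
  ∀ k → (∀ c → countBefore w c (k * 2) ≡ k) →
  w (k * 2) ≡ w k × w (suc (k * 2)) ≡ flip (w k)
selfRelative-recurrence-step {w} w∈𝒲 self k balanced
  with first-occurrence (infOften w∈𝒲 (flip (w (k * 2)))) (k * 2)
... | zero , w[2k]≡flip , _ = contradiction (sym w[2k]≡flip) (flip-≢ _)
... | suc e , w[1+e+2k]≡flip , count
  with selfRelative-gap self (w (k * 2)) k (k * 2) e
         (refl , cong suc (balanced _)) (w[1+e+2k]≡flip , cong suc (trans count (balanced _)))
... | w[k]≡w[2k] , refl = sym w[k]≡w[2k] , trans w[1+e+2k]≡flip (cong flip (sym w[k]≡w[2k]))

selfRelative⇒recurrence : In𝒲 w → SelfRelative w → ThueMorseRecurrence w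
selfRelative⇒recurrence {w} w∈𝒲 self k = selfRelative-recurrence-step w∈𝒲 self k (balanced k)
  where
  balanced : ∀ k c → countBefore w c (k * 2) ≡ k
  balanced zero    c = refl
  balanced (suc k) c = trans (countBefore-pair w (k * 2) differ) (cong suc (balanced k c))
    where
    differ : w (suc (k * 2)) ≡ flip (w (k * 2))
    differ with w[2k]≡w[k] , w[2k+1]≡flip ← selfRelative-recurrence-step w∈𝒲 self k (balanced k)
      = trans w[2k+1]≡flip (cong flip (sym w[2k]≡w[k]))

concatMap-prefix : (f : A → List A) → Prefix _≡_ xs ys → Prefix _≡_ (concatMap f xs) (concatMap f ys)
concatMap-prefix f []          = []
concatMap-prefix f (refl ∷ rs) = ++⁺ (Pointwise.refl refl) (concatMap-prefix f rs)

ρTM^-prefix-suc : ∀ k → Prefix _≡_ (ρTM^ k) (ρTM^ (suc k))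
ρTM^-prefix-suc zero    = refl ∷ []
ρTM^-prefix-suc (suc k) = concatMap-prefix ρTM (ρTM^-prefix-suc k)

ρTM^-prefix : k ≤′ k′ → Prefix _≡_ (ρTM^ k) (ρTM^ k′)
ρTM^-prefix ≤′-refl              = fromPointwise (Pointwise.refl refl)
ρTM^-prefix (≤′-step {k″} k≤′k″) = Prefix.trans trans (ρTM^-prefix k≤′k″) (ρTM^-prefix-suc k″)

lookup-prefix : {xs ys : List A} → Prefix _≡_ xs ys → (p : i < length xs) (q : i < length ys) →
  lookup xs (fromℕ< p) ≡ lookup ys (fromℕ< q)
lookup-prefix {i = zero}  (x≡y ∷ _) (s≤s _) (s≤s _) = x≡y
lookup-prefix {i = suc i} (_ ∷ rs)  (s≤s p) (s≤s q) = lookup-prefix rs p q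

length-concatMap-ρTM : ∀ xs → length (concatMap ρTM xs) ≡ length xs * 2
length-concatMap-ρTM []       = refl
length-concatMap-ρTM (a ∷ xs) = cong (λ n → suc (suc n)) (length-concatMap-ρTM xs)
length-concatMap-ρTM (b ∷ xs) = cong (λ n → suc (suc n)) (length-concatMap-ρTM xs)

n<length-ρTM^ : ∀ n → n < length (ρTM^ n)
n<length-ρTM^ zero    = s≤s z≤n
n<length-ρTM^ (suc n) = subst (suc n <_) (sym (length-concatMap-ρTM (ρTM^ n)))
  (≤-trans (s≤s (s≤s (m≤m*n n 2))) (*-monoˡ-≤ 2 (n<length-ρTM^ n)))

wTM-lookup : ∀ {n k} (p : n < length (ρTM^ k)) → wTM n ≡ lookup (ρTM^ k) (fromℕ< p)
wTM-lookup {n} {k} p with ≤-total n k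
... | inj₁ n≤k = lookup-prefix (ρTM^-prefix (≤⇒≤′ n≤k)) (n<length-ρTM^ n) p
... | inj₂ k≤n = sym (lookup-prefix (ρTM^-prefix (≤⇒≤′ k≤n)) p (n<length-ρTM^ n))

lookup-concatMap-ρTM-even : ∀ xs {j} (p : j * 2 < length (concatMap ρTM xs)) (q : j < length xs) →
  lookup (concatMap ρTM xs) (fromℕ< p) ≡ lookup xs (fromℕ< q)
lookup-concatMap-ρTM-even (a ∷ xs) {zero}  _             _       = refl
lookup-concatMap-ρTM-even (b ∷ xs) {zero}  _             _       = refl
lookup-concatMap-ρTM-even (a ∷ xs) {suc j} (s≤s (s≤s p)) (s≤s q) = lookup-concatMap-ρTM-even xs p q
lookup-concatMap-ρTM-even (b ∷ xs) {suc j} (s≤s (s≤s p)) (s≤s q) = lookup-concatMap-ρTM-even xs p q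

lookup-concatMap-ρTM-odd : ∀ xs {j} (p : suc (j * 2) < length (concatMap ρTM xs)) (q : j < length xs) →
  lookup (concatMap ρTM xs) (fromℕ< p) ≡ flip (lookup xs (fromℕ< q))
lookup-concatMap-ρTM-odd (a ∷ xs) {zero}  _             _       = refl
lookup-concatMap-ρTM-odd (b ∷ xs) {zero}  _             _       = refl
lookup-concatMap-ρTM-odd (a ∷ xs) {suc j} (s≤s (s≤s p)) (s≤s q) = lookup-concatMap-ρTM-odd xs p q
lookup-concatMap-ρTM-odd (b ∷ xs) {suc j} (s≤s (s≤s p)) (s≤s q) = lookup-concatMap-ρTM-odd xs p q

wTM-recurrence : ThueMorseRecurrence wTM
wTM-recurrence j =
    trans (wTM-lookup {k = suc j} even<) (lookup-concatMap-ρTM-even (ρTM^ j) even< j<)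
  , trans (wTM-lookup {k = suc j} odd<) (lookup-concatMap-ρTM-odd (ρTM^ j) odd< j<)
  where
  j< : j < length (ρTM^ j)
  j< = n<length-ρTM^ j

  length≡ : length (ρTM^ (suc j)) ≡ length (ρTM^ j) * 2
  length≡ = length-concatMap-ρTM (ρTM^ j)

  odd< : suc (j * 2) < length (ρTM^ (suc j))
  odd< = subst (suc (j * 2) <_) (sym length≡) (*-monoˡ-≤ 2 j<)

  even< : j * 2 < length (ρTM^ (suc j))
  even< = <⇒≤ odd<

theorem6p3 : (In𝒲 wTM × wTM 0 ≡ a × SelfRelative wTM)
    × (∀ (w : Word) → In𝒲 w → w 0 ≡ a → SelfRelative w → ∀ n → w n ≡ wTM n)
theorem6p3 =
    ( (infOften-TM a , infOften-TM b) , refl , recurrence⇒selfRelative wTM-recurrence )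
  , λ w w∈𝒲 w₀≡a self → recurrence-unique (selfRelative⇒recurrence w∈𝒲 self) wTM-recurrence w₀≡a
  where
  infOften-TM : ∀ c → InfOften wTM c
  infOften-TM = pairsDiffer⇒infOften (recurrence⇒pairsDiffer wTM-recurrence)
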